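{- For every integer $m\ge 2$, the path $P_m$ on $m$ vertices is not a $\langle 2,2\rangle$ CCE graph; that is, no $\langle 2,2\rangle$ digraph has CCE graph isomorphic to a nontrivial path.
   Context: All graphs and digraphs are simple (no loops, no multiple arcs). The CCE graph $CCE(D)$ of a digraph $D$ is the graph on $V(D)$ in which distinct $u,v$ are adjacent iff there exist vertices $x,y$ with $(y,u),(y,v),(u,x),(v,x)$ all arcs of $D$. A $\langle 2,2\rangle$ digraph is a digraph in which every vertex has indegree at most $2$ and outdegree at most $2$; a $\langle 2,2\rangle$ CCE graph is the CCE graph of some $\langle 2,2\rangle$ digraph. -}

module Defs where

open import Data.Nat using (ℕ; suc; _≤_; _≥_)
open import Data.Fin using (Fin; toℕ)
open import Data.Bool using (Bool; true; false; T)
open import Data.List using (length; filter; allFin)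
open import Data.Product using (∃; ∃-syntax; _×_)
open import Data.Sum using (_⊎_)
open import Relation.Nullary using (¬_)
open import Relation.Binary.PropositionalEquality using (_≡_; _≢_)
open import Data.Bool.Properties using (T?)
open import Function.Bundles using (_↔_; Inverse)

record Digraph (n : ℕ) : Set where
  field
    arc   : Fin n → Fin n → Bool
    loopless : ∀ v → arc v v ≡ false
open Digraph public

indeg : ∀ {n} → Digraph n → Fin n → ℕ
indeg {n} D v = length (filter (λ y → T? (arc D y v)) (allFin n))

outdeg : ∀ {n} → Digraph n → Fin n → ℕ
outdeg {n} D v = length (filter (λ x → T? (arc D v x)) (allFin n))

Is22 : ∀ {n} → Digraph n → Set
Is22 D = ∀ v → indeg D v ≤ 2 × outdeg D v ≤ 2

CCEAdj : ∀ {n} → Digraph n → Fin n → Fin n → Set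
CCEAdj D u v =
  u ≢ v × ∃[ x ] ∃[ y ]
    (T (arc D y u) × T (arc D y v) × T (arc D u x) × T (arc D v x))

PathAdj : (m : ℕ) → Fin m → Fin m → Set
PathAdj m i j = toℕ j ≡ suc (toℕ i) ⊎ toℕ i ≡ suc (toℕ j)

record Iso {n m : ℕ} (G : Fin n → Fin n → Set) (H : Fin m → Fin m → Set) : Set where
  field
    bij      : Fin n ↔ Fin m
  open Inverse bij public
  field
    preserve : ∀ u v → G u v → H (to u) (to v)
    reflect  : ∀ u v → H (to u) (to v) → G u v

-- In a realisation of the path 0 – 1 – ⋯ – M, every edge i – i+1 has a common
-- in-neighbour s(i) whose two out-arcs go to i and i+1; the s(i) are distinct, so
-- all vertices but one are of this form and the remaining one can only point at
-- the ends 0 and M. Hence every vertex k points into a cyclic window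
-- {w(k), w(k)+1} (mod M+1), where w is a permutation of 0, …, M. A common
-- out-neighbour of k and k+1 forces w(k+1) = w(k) ± 1, and injectivity of w
-- forbids the sign to change. If w ascends, then 0 and M acquire common in- and
-- out-neighbours (a CCE edge closing the path into a cycle) or a loop appears;
-- if w descends, the common out-neighbour at the midpoint of w(k) + k = w(0) is
-- a loop.
module Submission where

open import Defs
open import Data.Bool using (T)
open import Data.Bool.Properties using (T?)
open import Data.Empty using (⊥; ⊥-elim)
open import Data.Fin as Fin using (Fin; toℕ; fromℕ<; punchOut)
open import Data.Fin.Properties using (any?; pigeonhole; punchOut-injective; toℕ<n; toℕ-fromℕ<; fromℕ<-toℕ)
open import Data.List using (length; filter; allFin)
open import Data.List.Membership.Propositional using (_∈_)
open import Data.List.Membership.Propositional.Properties using (∈-filter⁺; ∈-allFin)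
open import Data.List.Relation.Unary.Any using (here; there)
open import Data.Nat using (ℕ; zero; suc; _+_; _∸_; _≤_; _<_; z≤n; s≤s; s≤s⁻¹; _≥_; _≟_; _≤?_; _<?_; ⌊_/2⌋; ⌈_/2⌉)
open import Data.Nat.Properties
open import Data.Product using (Σ; ∃-syntax; _×_; _,_; proj₁; proj₂; map₂)
open import Data.Sum as Sum using (_⊎_; inj₁; inj₂; [_,_]′)
open import Function using (_∘_)
open import Relation.Binary.PropositionalEquality
open import Relation.Nullary using (¬_; yes; no; contradiction)
open import Relation.Unary using (Decidable)

n≢2+n : ∀ n → n ≢ suc (suc n)
n≢2+n (suc n) eq = n≢2+n n (suc-injective eq)

⌈n/2⌉≡⌊n/2⌋⊎1+⌊n/2⌋ : ∀ n → ⌈ n /2⌉ ≡ ⌊ n /2⌋ ⊎ ⌈ n /2⌉ ≡ suc ⌊ n /2⌋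
⌈n/2⌉≡⌊n/2⌋⊎1+⌊n/2⌋ zero          = inj₁ refl
⌈n/2⌉≡⌊n/2⌋⊎1+⌊n/2⌋ (suc zero)    = inj₂ refl
⌈n/2⌉≡⌊n/2⌋⊎1+⌊n/2⌋ (suc (suc n)) = Sum.map (cong suc) (cong suc) (⌈n/2⌉≡⌊n/2⌋⊎1+⌊n/2⌋ n)

n∸⌊n/2⌋≡⌈n/2⌉ : ∀ n → n ∸ ⌊ n /2⌋ ≡ ⌈ n /2⌉
n∸⌊n/2⌋≡⌈n/2⌉ n = begin
  n ∸ ⌊ n /2⌋                   ≡⟨ cong (_∸ ⌊ n /2⌋) (⌊n/2⌋+⌈n/2⌉≡n n) ⟨
  ⌊ n /2⌋ + ⌈ n /2⌉ ∸ ⌊ n /2⌋   ≡⟨ m+n∸m≡n ⌊ n /2⌋ ⌈ n /2⌉ ⟩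
  ⌈ n /2⌉                       ∎
  where open ≡-Reasoning

⌊n/2⌋<m : ∀ {m n} → 0 < m → n ≤ m → ⌊ n /2⌋ < m
⌊n/2⌋<m {n = zero}  0<m _   = 0<m
⌊n/2⌋<m {n = suc n} _   n≤m = <-≤-trans (⌊n/2⌋<n n) n≤m

AtMostTwo : {A : Set} → (A → Set) → Set
AtMostTwo P = ∀ {a b c} → P a → P b → P c → a ≡ b ⊎ a ≡ c ⊎ b ≡ c

module _ {A : Set} where

  ∈⇒1≤length : ∀ {a : A} {xs} → a ∈ xs → 1 ≤ length xs
  ∈⇒1≤length (here _)  = s≤s z≤n
  ∈⇒1≤length (there _) = s≤s z≤n

  distinct-∈⇒2≤length : ∀ {a b : A} {xs} → a ≢ b → a ∈ xs → b ∈ xs → 2 ≤ length xs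
  distinct-∈⇒2≤length a≢b (here refl) (here refl) = contradiction refl a≢b
  distinct-∈⇒2≤length a≢b (here _)    (there b∈)  = s≤s (∈⇒1≤length b∈)
  distinct-∈⇒2≤length a≢b (there a∈)  (here _)    = s≤s (∈⇒1≤length a∈)
  distinct-∈⇒2≤length a≢b (there a∈)  (there b∈)  = m≤n⇒m≤1+n (distinct-∈⇒2≤length a≢b a∈ b∈)

  distinct-∈⇒3≤length : ∀ {a b c : A} {xs} → a ≢ b → a ≢ c → b ≢ c →
                        a ∈ xs → b ∈ xs → c ∈ xs → 3 ≤ length xs
  distinct-∈⇒3≤length a≢b a≢c b≢c (here refl) (here refl) _           = contradiction refl a≢b
  distinct-∈⇒3≤length a≢b a≢c b≢c (here refl) (there _)   (here refl) = contradiction refl a≢c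
  distinct-∈⇒3≤length a≢b a≢c b≢c (there _)   (here refl) (here refl) = contradiction refl b≢c
  distinct-∈⇒3≤length a≢b a≢c b≢c (here _)    (there b∈)  (there c∈)  = s≤s (distinct-∈⇒2≤length b≢c b∈ c∈)
  distinct-∈⇒3≤length a≢b a≢c b≢c (there a∈)  (here _)    (there c∈)  = s≤s (distinct-∈⇒2≤length a≢c a∈ c∈)
  distinct-∈⇒3≤length a≢b a≢c b≢c (there a∈)  (there b∈)  (here _)    = s≤s (distinct-∈⇒2≤length a≢b a∈ b∈)
  distinct-∈⇒3≤length a≢b a≢c b≢c (there a∈)  (there b∈)  (there c∈)  =
    m≤n⇒m≤1+n (distinct-∈⇒3≤length a≢b a≢c b≢c a∈ b∈ c∈)

filter-length≤2⇒AtMostTwo : ∀ {n} {P : Fin n → Set} (P? : Decidable P) →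
                            length (filter P? (allFin n)) ≤ 2 → AtMostTwo P
filter-length≤2⇒AtMostTwo {n} {P} P? ≤2 {a} {b} {c} pa pb pc with a Fin.≟ b | a Fin.≟ c | b Fin.≟ c
... | yes a≡b | _       | _       = inj₁ a≡b
... | no _    | yes a≡c | _       = inj₂ (inj₁ a≡c)
... | no _    | no _    | yes b≡c = inj₂ (inj₂ b≡c)
... | no a≢b  | no a≢c  | no b≢c  =
  contradiction (≤-trans (distinct-∈⇒3≤length a≢b a≢c b≢c (∈P pa) (∈P pb) (∈P pc)) ≤2) (<-irrefl refl)
  where
  ∈P : ∀ {x} → P x → x ∈ filter P? (allFin n)
  ∈P = ∈-filter⁺ P? (∈-allFin _)

module _ {N : ℕ} (f : ℕ → ℕ) (f≤N : ∀ {i} → i ≤ N → f i ≤ N)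
         (f-injective : ∀ {i j} → i ≤ N → j ≤ N → f i ≡ f j → i ≡ j) where

  -- Punching a missed value out of the range squeezes N+1 points injectively into N.
  private module Missed {v} (v≤N : v ≤ N) (missed : ∀ {i} → i ≤ N → f i ≢ v) where
    open ≡-Reasoning

    bound : (i : Fin (suc N)) → toℕ i ≤ N
    bound i = s≤s⁻¹ (toℕ<n i)

    F : Fin (suc N) → Fin (suc N)
    F i = fromℕ< (s≤s (f≤N (bound i)))

    v′ : Fin (suc N)
    v′ = fromℕ< (s≤s v≤N)

    v′≢F : ∀ i → v′ ≢ F i
    v′≢F i v′≡Fi = missed (bound i) (begin
      f (toℕ i)  ≡⟨ toℕ-fromℕ< _ ⟨
      toℕ (F i)  ≡⟨ cong toℕ v′≡Fi ⟨
      toℕ v′     ≡⟨ toℕ-fromℕ< _ ⟩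
      v          ∎)

    f-toℕ-injective : ∀ {i j} → punchOut (v′≢F i) ≡ punchOut (v′≢F j) → f (toℕ i) ≡ f (toℕ j)
    f-toℕ-injective {i} {j} eq = begin
      f (toℕ i)  ≡⟨ toℕ-fromℕ< _ ⟨
      toℕ (F i)  ≡⟨ cong toℕ (punchOut-injective (v′≢F i) (v′≢F j) eq) ⟩
      toℕ (F j)  ≡⟨ toℕ-fromℕ< _ ⟩
      f (toℕ j)  ∎

    impossible : ⊥
    impossible with i , j , i<j , eq ← pigeonhole (n<1+n N) (λ i → punchOut (v′≢F i))
      = <-irrefl (f-injective (bound i) (bound j) (f-toℕ-injective eq)) i<j

  injective⇒surjective : ∀ {v} → v ≤ N → ∃[ i ] i ≤ N × f i ≡ v
  injective⇒surjective {v} v≤N with any? (λ (i : Fin (suc N)) → f (toℕ i) ≟ v)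
  ... | yes (i , fi≡v) = toℕ i , s≤s⁻¹ (toℕ<n i) , fi≡v
  ... | no ∄i = ⊥-elim (Missed.impossible v≤N missed)
    where
    missed : ∀ {i} → i ≤ N → f i ≢ v
    missed {i} i≤N fi≡v = ∄i (fromℕ< (s≤s i≤N) , trans (cong f (toℕ-fromℕ< _)) fi≡v)

record CommonNeighbours {V : Set} (A : V → V → Set) (u v : V) : Set where
  constructor commonNeighbours
  field
    {source sink} : V
    source-u : A source u
    source-v : A source v
    u-sink   : A u sink
    v-sink   : A v sink

module PathRealisation
  {M : ℕ} (1≤M : 1 ≤ M) {A : ℕ → ℕ → Set}
  (A-bounded       : ∀ {i j} → A i j → i ≤ M × j ≤ M)
  (A-irreflexive   : ∀ {i} → ¬ A i i)
  (out-atMostTwo   : ∀ w → AtMostTwo (A w))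
  (in-atMostTwo    : ∀ w → AtMostTwo (λ v → A v w))
  (edge-realised   : ∀ {i} → i < M → CommonNeighbours A i (suc i))
  (ends-unrealised : 2 ≤ M → ¬ CommonNeighbours A 0 M)
  where

  open ≡-Reasoning

  A⇒≢ : ∀ {i j} → A i j → i ≢ j
  A⇒≢ a refl = A-irreflexive a

  -- For i ≥ M the junk value 0 is returned.
  source sink : ℕ → ℕ
  source i with i <? M
  ... | yes i<M = CommonNeighbours.source (edge-realised i<M)
  ... | no _    = 0
  sink i with i <? M
  ... | yes i<M = CommonNeighbours.sink (edge-realised i<M)
  ... | no _    = 0

  source-arcs : ∀ {i} → i < M → A (source i) i × A (source i) (suc i)
  source-arcs {i} i<M with i <? M
  ... | yes i<M′ = let open CommonNeighbours (edge-realised i<M′) in source-u , source-v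
  ... | no i≮M   = contradiction i<M i≮M

  sink-arcs : ∀ {i} → i < M → A i (sink i) × A (suc i) (sink i)
  sink-arcs {i} i<M with i <? M
  ... | yes i<M′ = let open CommonNeighbours (edge-realised i<M′) in u-sink , v-sink
  ... | no i≮M   = contradiction i<M i≮M

  source-≤ : ∀ {i} → i < M → source i ≤ M
  source-≤ i<M = proj₁ (A-bounded (proj₁ (source-arcs i<M)))

  source-out : ∀ {i j} → i < M → A (source i) j → j ≡ i ⊎ j ≡ suc i
  source-out i<M a with out-atMostTwo _ (proj₁ (source-arcs i<M)) (proj₂ (source-arcs i<M)) a
  ... | inj₁ i≡1+i  = contradiction (sym i≡1+i) 1+n≢n
  ... | inj₂ j≡i⊎1+i = Sum.map sym sym j≡i⊎1+i

  source-injective : ∀ {i j} → i < M → j < M → source i ≡ source j → i ≡ j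
  source-injective {i} {j} i<M j<M si≡sj
    with source-out i<M (subst (λ s → A s j) (sym si≡sj) (proj₁ (source-arcs j<M)))
       | source-out j<M (subst (λ s → A s i) si≡sj (proj₁ (source-arcs i<M)))
  ... | inj₁ j≡i   | _          = sym j≡i
  ... | inj₂ _     | inj₁ i≡j   = i≡j
  ... | inj₂ j≡1+i | inj₂ i≡1+j = contradiction (trans j≡1+i (cong suc i≡1+j)) (n≢2+n j)

  source-in : ∀ {i w} → suc i < M → A w (suc i) → w ≡ source i ⊎ w ≡ source (suc i)
  source-in 1+i<M a with in-atMostTwo _ (proj₂ (source-arcs (<⇒≤ 1+i<M))) (proj₁ (source-arcs 1+i<M)) a
  ... | inj₁ si≡s1+i = contradiction (sym (source-injective (<⇒≤ 1+i<M) 1+i<M si≡s1+i)) 1+n≢n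
  ... | inj₂ cases   = Sum.map sym sym cases

  NonSource : ℕ → Set
  NonSource k = ∀ {i} → i < M → source i ≢ k

  nonSource-out : ∀ {k j} → NonSource k → A k j → j ≡ 0 ⊎ j ≡ M
  nonSource-out {j = zero}  _  _ = inj₁ refl
  nonSource-out {j = suc j} k∉ a with suc j <? M
  ... | no 1+j≮M  = inj₂ (≤∧≮⇒≡ (proj₂ (A-bounded a)) 1+j≮M)
  ... | yes 1+j<M = ⊥-elim ([ k∉ (<⇒≤ 1+j<M) ∘ sym , k∉ 1+j<M ∘ sym ]′ (source-in 1+j<M a))

  private
    sourceOr : ℕ → ℕ → ℕ
    sourceOr k i with i <? M
    ... | yes _ = source i
    ... | no _  = k

    sourceOr-≤ : ∀ {k} → k ≤ M → ∀ {i} → i ≤ M → sourceOr k i ≤ M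
    sourceOr-≤ k≤M {i} _ with i <? M
    ... | yes i<M = source-≤ i<M
    ... | no _    = k≤M

    sourceOr-injective : ∀ {k} → NonSource k → ∀ {i j} → i ≤ M → j ≤ M →
                         sourceOr k i ≡ sourceOr k j → i ≡ j
    sourceOr-injective k∉ {i} {j} i≤M j≤M eq with i <? M | j <? M
    ... | yes i<M | yes j<M = source-injective i<M j<M eq
    ... | yes i<M | no _    = contradiction eq (k∉ i<M)
    ... | no _    | yes j<M = contradiction (sym eq) (k∉ j<M)
    ... | no i≮M  | no j≮M  = trans (≤∧≮⇒≡ i≤M i≮M) (sym (≤∧≮⇒≡ j≤M j≮M))

  -- Extending source by k at M gives an injective, hence surjective, self-map of 0, …, M.
  nonSource-unique : ∀ {k l} → k ≤ M → l ≤ M → NonSource k → NonSource l → k ≡ l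
  nonSource-unique {k} k≤M l≤M k∉ l∉
    with i , _ , sourceOr-i≡l ← injective⇒surjective (sourceOr k) (sourceOr-≤ k≤M) (sourceOr-injective k∉) l≤M
    with i <? M
  ... | yes i<M = contradiction sourceOr-i≡l (l∉ i<M)
  ... | no _    = sourceOr-i≡l

  next : ℕ → ℕ
  next a with a <? M
  ... | yes _ = suc a
  ... | no _  = 0

  next-< : ∀ {a} → a < M → next a ≡ suc a
  next-< {a} a<M with a <? M
  ... | yes _  = refl
  ... | no a≮M = contradiction a<M a≮M

  next-M : next M ≡ 0
  next-M with M <? M
  ... | yes M<M = contradiction M<M (<-irrefl refl)
  ... | no _    = refl

  next-cases : ∀ {a} → a ≤ M → (a < M × next a ≡ suc a) ⊎ (a ≡ M × next a ≡ 0)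
  next-cases a≤M with m≤n⇒m<n∨m≡n a≤M
  ... | inj₁ a<M  = inj₁ (a<M , next-< a<M)
  ... | inj₂ refl = inj₂ (refl , next-M)

  next-≤ : ∀ {a} → a ≤ M → next a ≤ M
  next-≤ a≤M with next-cases a≤M
  ... | inj₁ (a<M , eq) = subst (_≤ M) (sym eq) a<M
  ... | inj₂ (_ , eq)   = subst (_≤ M) (sym eq) z≤n

  next-injective : ∀ {a b} → a ≤ M → b ≤ M → next a ≡ next b → a ≡ b
  next-injective a≤M b≤M eq with next-cases a≤M | next-cases b≤M
  ... | inj₁ (_ , ea) | inj₁ (_ , eb) = suc-injective (trans (sym ea) (trans eq eb))
  ... | inj₂ (a≡M , _) | inj₂ (b≡M , _) = trans a≡M (sym b≡M)
  ... | inj₁ (_ , ea) | inj₂ (_ , eb) = contradiction (trans (sym eb) (trans (sym eq) ea)) 0≢1+n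
  ... | inj₂ (_ , ea) | inj₁ (_ , eb) = contradiction (trans (sym ea) (trans eq eb)) 0≢1+n

  locate : ∀ k → (∃[ i ] i < M × source i ≡ k) ⊎ NonSource k
  locate k with any? (λ (i : Fin M) → source (toℕ i) ≟ k)
  ... | yes (i , si≡k) = inj₁ (toℕ i , toℕ<n i , si≡k)
  ... | no ∄i = inj₂ λ i<M si≡k → ∄i (fromℕ< i<M , trans (cong source (toℕ-fromℕ< i<M)) si≡k)

  window : ℕ → ℕ
  window k = [ proj₁ , (λ _ → M) ]′ (locate k)

  window-cases : ∀ k → (window k < M × source (window k) ≡ k) ⊎ (window k ≡ M × NonSource k)
  window-cases k with locate k
  ... | inj₁ (_ , i<M , si≡k) = inj₁ (i<M , si≡k)
  ... | inj₂ k∉               = inj₂ (refl , k∉)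

  window-≤ : ∀ k → window k ≤ M
  window-≤ k = [ <⇒≤ ∘ proj₁ , ≤-reflexive ∘ proj₁ ]′ (window-cases k)

  window-injective : ∀ {k l} → k ≤ M → l ≤ M → window k ≡ window l → k ≡ l
  window-injective {k} {l} k≤M l≤M eq with window-cases k | window-cases l
  ... | inj₁ (_ , sk) | inj₁ (_ , sl) = trans (sym sk) (trans (cong source eq) sl)
  ... | inj₂ (_ , k∉) | inj₂ (_ , l∉) = nonSource-unique k≤M l≤M k∉ l∉
  ... | inj₁ (k<M , _) | inj₂ (l≡M , _) = contradiction (trans eq l≡M) (<⇒≢ k<M)
  ... | inj₂ (k≡M , _) | inj₁ (l<M , _) = contradiction (trans (sym eq) k≡M) (<⇒≢ l<M)

  window-surjective : ∀ {v} → v ≤ M → ∃[ k ] k ≤ M × window k ≡ v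
  window-surjective = injective⇒surjective window (λ {k} _ → window-≤ k) window-injective

  out⊆window : ∀ {k j} → A k j → j ≡ window k ⊎ j ≡ next (window k)
  out⊆window {k} a with window-cases k
  ... | inj₁ (w<M , sw≡k) =
    Sum.map₂ (λ j≡1+w → trans j≡1+w (sym (next-< w<M))) (source-out w<M (subst (λ s → A s _) (sym sw≡k) a))
  ... | inj₂ (w≡M , k∉) =
    [ (λ j≡0 → inj₂ (trans j≡0 (sym (trans (cong next w≡M) next-M)))) , (λ j≡M → inj₁ (trans j≡M (sym w≡M))) ]′
      (nonSource-out k∉ a)

  window-arcs : ∀ {k} → window k < M → A k (window k) × A k (next (window k))
  window-arcs {k} w<M with window-cases k
  ... | inj₁ (_ , sw≡k) = subst (λ s → A s (window k) × A s (next (window k))) sw≡k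
                            (map₂ (subst (A (source (window k))) (sym (next-< w<M))) (source-arcs w<M))
  ... | inj₂ (w≡M , _)  = contradiction w≡M (<⇒≢ w<M)

  Ascends Descends : ℕ → Set
  Ascends  k = window (suc k) ≡ next (window k)
  Descends k = window k ≡ next (window (suc k))

  window-suc≢ : ∀ {k} → k < M → window k ≢ window (suc k)
  window-suc≢ k<M eq = 1+n≢n (sym (window-injective (<⇒≤ k<M) k<M eq))

  ascends⊎descends : ∀ {k} → k < M → Ascends k ⊎ Descends k
  ascends⊎descends {k} k<M with out⊆window (proj₁ (sink-arcs k<M)) | out⊆window (proj₂ (sink-arcs k<M))
  ... | inj₁ x≡w  | inj₁ x≡w′  = contradiction (trans (sym x≡w) x≡w′) (window-suc≢ k<M)
  ... | inj₁ x≡w  | inj₂ x≡nw′ = inj₂ (trans (sym x≡w) x≡nw′)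
  ... | inj₂ x≡nw | inj₁ x≡w′  = inj₁ (trans (sym x≡w′) x≡nw)
  ... | inj₂ x≡nw | inj₂ x≡nw′ =
    contradiction (next-injective (window-≤ k) (window-≤ (suc k)) (trans (sym x≡nw) x≡nw′)) (window-suc≢ k<M)

  ascends-descends⇒⊥ : ∀ {k} → suc k < M → Ascends k → Descends (suc k) → ⊥
  ascends-descends⇒⊥ {k} 1+k<M asc desc = n≢2+n k
    (window-injective (<⇒≤ (<⇒≤ 1+k<M)) 1+k<M
      (next-injective (window-≤ k) (window-≤ (suc (suc k))) (trans (sym asc) desc)))

  descends-ascends⇒⊥ : ∀ {k} → suc k < M → Descends k → Ascends (suc k) → ⊥
  descends-ascends⇒⊥ {k} 1+k<M desc asc =
    n≢2+n k (window-injective (<⇒≤ (<⇒≤ 1+k<M)) 1+k<M (trans desc (sym asc)))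

  ascending⊎descending : (∀ {k} → k < M → Ascends k) ⊎ (∀ {k} → k < M → Descends k)
  ascending⊎descending = Sum.map ascending descending (ascends⊎descends 1≤M)
    where
    ascending : Ascends 0 → ∀ {k} → k < M → Ascends k
    ascending asc₀ {zero}  _ = asc₀
    ascending asc₀ {suc k} 1+k<M with ascends⊎descends 1+k<M
    ... | inj₁ asc  = asc
    ... | inj₂ desc = ⊥-elim (ascends-descends⇒⊥ 1+k<M (ascending asc₀ (<⇒≤ 1+k<M)) desc)

    descending : Descends 0 → ∀ {k} → k < M → Descends k
    descending desc₀ {zero}  _ = desc₀
    descending desc₀ {suc k} 1+k<M with ascends⊎descends 1+k<M
    ... | inj₂ desc = desc
    ... | inj₁ asc  = ⊥-elim (descends-ascends⇒⊥ 1+k<M (descending desc₀ (<⇒≤ 1+k<M)) asc)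

  module Long (2≤M : 2 ≤ M) where

    next²-≢ : ∀ {a} → a ≤ M → next (next a) ≢ a
    next²-≢ {a} a≤M nna≡a with next-cases a≤M
    ... | inj₂ (a≡M , na≡0) = <-irrefl (begin
      1               ≡⟨ next-< 1≤M ⟨
      next 0          ≡⟨ cong next na≡0 ⟨
      next (next a)   ≡⟨ nna≡a ⟩
      a               ≡⟨ a≡M ⟩
      M               ∎) 2≤M
    ... | inj₁ (a<M , na≡1+a) with next-cases a<M
    ...   | inj₁ (_ , n1+a≡2+a) = n≢2+n _ (trans (sym nna≡a) (trans (cong next na≡1+a) n1+a≡2+a))
    ...   | inj₂ (1+a≡M , n1+a≡0) =
      <-irrefl (trans (cong suc (trans (sym n1+a≡0) (trans (cong next (sym na≡1+a)) nna≡a))) 1+a≡M) 2≤M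

    module _ (asc : ∀ {k} → k < M → Ascends k) where

      sink≡next-window : ∀ {k} → k < M → sink k ≡ next (window k)
      sink≡next-window {k} k<M with out⊆window (proj₁ (sink-arcs k<M)) | out⊆window (proj₂ (sink-arcs k<M))
      ... | inj₂ x≡nw | _ = x≡nw
      ... | inj₁ x≡w  | inj₁ x≡w′  = contradiction (trans (sym x≡w) x≡w′) (window-suc≢ k<M)
      ... | inj₁ x≡w  | inj₂ x≡nw′ =
        contradiction (trans (cong next (sym (asc k<M))) (trans (sym x≡nw′) x≡w)) (next²-≢ (window-≤ k))

      next-window-M : next (window M) ≡ window 0
      next-window-M with window-surjective (next-≤ (window-≤ M))
      ... | zero  , _     , w0≡ = sym w0≡
      ... | suc j , 1+j≤M , w1+j≡ = contradiction
        (window-injective (<⇒≤ 1+j≤M) ≤-refl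
          (next-injective (window-≤ j) (window-≤ M) (trans (sym (asc 1+j≤M)) w1+j≡)))
        (<⇒≢ 1+j≤M)

      window-0≢M : window 0 ≢ M
      window-0≢M w0≡M = A⇒≢ (proj₁ (sink-arcs 1≤M)) (sym (begin
        sink 0           ≡⟨ sink≡next-window 1≤M ⟩
        next (window 0)  ≡⟨ cong next w0≡M ⟩
        next M           ≡⟨ next-M ⟩
        0                ∎))

      window-M≢M : window M ≢ M
      window-M≢M wM≡M = A⇒≢ (proj₂ (sink-arcs 1≤M)) (sym (begin
        sink 0                  ≡⟨ sink≡next-window 1≤M ⟩
        next (window 0)         ≡⟨ cong next next-window-M ⟨
        next (next (window M))  ≡⟨ cong (next ∘ next) wM≡M ⟩
        next (next M)           ≡⟨ cong next next-M ⟩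
        next 0                  ≡⟨ next-< 1≤M ⟩
        1                       ∎))

      -- The non-source vertex suc z is a common in-neighbour of the ends, and window 0 a
      -- common out-neighbour.
      ends-realised : ∀ {z} → suc z < M → window (suc z) ≡ M → CommonNeighbours A 0 M
      ends-realised {z} 1+z<M w1+z≡M = record
        { source-u = subst (A (suc z)) sink-1+z≡0 (proj₁ (sink-arcs 1+z<M))
        ; source-v = subst (A (suc z)) sink-z≡M (proj₂ (sink-arcs (<⇒≤ 1+z<M)))
        ; u-sink   = proj₁ (window-arcs (window<M z≤n (λ ())))
        ; v-sink   = subst (A M) next-window-M (proj₂ (window-arcs (window<M ≤-refl (<⇒≢ 1+z<M ∘ sym))))
        }
        where
        window<M : ∀ {k} → k ≤ M → k ≢ suc z → window k < M
        window<M k≤M k≢1+z = ≤∧≢⇒< (window-≤ _)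
          (λ wk≡M → k≢1+z (window-injective k≤M (<⇒≤ 1+z<M) (trans wk≡M (sym w1+z≡M))))

        sink-1+z≡0 : sink (suc z) ≡ 0
        sink-1+z≡0 = trans (sink≡next-window 1+z<M) (trans (cong next w1+z≡M) next-M)

        sink-z≡M : sink z ≡ M
        sink-z≡M = trans (sink≡next-window (<⇒≤ 1+z<M)) (trans (sym (asc (<⇒≤ 1+z<M))) w1+z≡M)

      ascending⇒⊥ : ⊥
      ascending⇒⊥ with window-surjective {M} ≤-refl
      ... | zero  , _     , w0≡M = window-0≢M w0≡M
      ... | suc z , 1+z≤M , w1+z≡M with m≤n⇒m<n∨m≡n 1+z≤M
      ...   | inj₁ 1+z<M = ends-unrealised 2≤M (ends-realised 1+z<M w1+z≡M)
      ...   | inj₂ 1+z≡M = window-M≢M (subst (λ k → window k ≡ M) 1+z≡M w1+z≡M)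

    module _ (desc : ∀ {k} → k < M → Descends k) where

      sink≡window : ∀ {k} → k < M → sink k ≡ window k
      sink≡window {k} k<M with out⊆window (proj₁ (sink-arcs k<M)) | out⊆window (proj₂ (sink-arcs k<M))
      ... | inj₁ x≡w  | _ = x≡w
      ... | inj₂ x≡nw | inj₁ x≡w′  =
        contradiction (trans (cong next (sym (desc k<M))) (trans (sym x≡nw) x≡w′)) (next²-≢ (window-≤ (suc k)))
      ... | inj₂ x≡nw | inj₂ x≡nw′ =
        contradiction (next-injective (window-≤ k) (window-≤ (suc k)) (trans (sym x≡nw) x≡nw′)) (window-suc≢ k<M)

      window≡window0∸ : ∀ {k} → k ≤ window 0 → window k ≡ window 0 ∸ k
      window≡window0∸ {zero}  _   = refl
      window≡window0∸ {suc k} k<a = next-injective (window-≤ (suc k)) (<⇒≤ a∸1+k<M) (begin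
        next (window (suc k))    ≡⟨ desc (<-≤-trans k<a (window-≤ 0)) ⟨
        window k                 ≡⟨ window≡window0∸ (<⇒≤ k<a) ⟩
        window 0 ∸ k             ≡⟨ +-∸-assoc 1 k<a ⟩
        suc (window 0 ∸ suc k)   ≡⟨ next-< a∸1+k<M ⟨
        next (window 0 ∸ suc k)  ∎)
        where
        a∸1+k<M : window 0 ∸ suc k < M
        a∸1+k<M = subst (_≤ M) (+-∸-assoc 1 k<a) (≤-trans (m∸n≤m (window 0) k) (window-≤ 0))

      midpoint<M : ⌊ window 0 /2⌋ < M
      midpoint<M = ⌊n/2⌋<m 1≤M (window-≤ 0)

      sink-midpoint : sink ⌊ window 0 /2⌋ ≡ ⌈ window 0 /2⌉
      sink-midpoint = begin
        sink ⌊ window 0 /2⌋        ≡⟨ sink≡window midpoint<M ⟩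
        window ⌊ window 0 /2⌋      ≡⟨ window≡window0∸ (⌊n/2⌋≤n (window 0)) ⟩
        window 0 ∸ ⌊ window 0 /2⌋  ≡⟨ n∸⌊n/2⌋≡⌈n/2⌉ (window 0) ⟩
        ⌈ window 0 /2⌉             ∎

      descending⇒⊥ : ⊥
      descending⇒⊥ with ⌈n/2⌉≡⌊n/2⌋⊎1+⌊n/2⌋ (window 0)
      ... | inj₁ ⌈a/2⌉≡h   = A⇒≢ (proj₁ (sink-arcs midpoint<M)) (sym (trans sink-midpoint ⌈a/2⌉≡h))
      ... | inj₂ ⌈a/2⌉≡1+h = A⇒≢ (proj₂ (sink-arcs midpoint<M)) (sym (trans sink-midpoint ⌈a/2⌉≡1+h))

  2≰M⇒⊥ : ¬ 2 ≤ M → ⊥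
  2≰M⇒⊥ 2≰M with source 0 | source-arcs 1≤M | source-≤ 1≤M
  ... | zero        | s→0 , _ | _      = A-irreflexive s→0
  ... | suc zero    | _ , s→1 | _      = A-irreflexive s→1
  ... | suc (suc _) | _       | 2+s≤M  = 2≰M (≤-trans (s≤s (s≤s z≤n)) 2+s≤M)

  impossible : ⊥
  impossible with 2 ≤? M
  ... | no 2≰M  = 2≰M⇒⊥ 2≰M
  ... | yes 2≤M = [ Long.ascending⇒⊥ 2≤M , Long.descending⇒⊥ 2≤M ]′ ascending⊎descending

module Positions {M n : ℕ} (D : Digraph n) (iso : Iso (CCEAdj D) (PathAdj (suc M))) where
  open Iso iso

  vertex : ∀ {i} → .(i ≤ M) → Fin n
  vertex i≤M = from (fromℕ< (s≤s i≤M))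

  position : Fin n → ℕ
  position u = toℕ (to u)

  position≤M : ∀ u → position u ≤ M
  position≤M u = s≤s⁻¹ (toℕ<n (to u))

  position-vertex : ∀ {i} (i≤M : i ≤ M) → position (vertex i≤M) ≡ i
  position-vertex i≤M = trans (cong toℕ (strictlyInverseˡ _)) (toℕ-fromℕ< _)

  vertex-position : ∀ u → vertex (position≤M u) ≡ u
  vertex-position u = trans (cong from (fromℕ<-toℕ (to u) _)) (strictlyInverseʳ u)

  vertex-injective : ∀ {i j} (i≤M : i ≤ M) (j≤M : j ≤ M) → vertex i≤M ≡ vertex j≤M → i ≡ j
  vertex-injective i≤M j≤M eq =
    trans (sym (position-vertex i≤M)) (trans (cong position eq) (position-vertex j≤M))

  Arc : ℕ → ℕ → Set
  Arc i j = Σ (i ≤ M) λ i≤M → Σ (j ≤ M) λ j≤M → T (arc D (vertex i≤M) (vertex j≤M))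

  arc⇒Arc : ∀ {u v} → T (arc D u v) → Arc (position u) (position v)
  arc⇒Arc {u} {v} uv = position≤M u , position≤M v ,
    subst₂ (λ a b → T (arc D a b)) (sym (vertex-position u)) (sym (vertex-position v)) uv

  Arc-bounded : ∀ {i j} → Arc i j → i ≤ M × j ≤ M
  Arc-bounded (i≤M , j≤M , _) = i≤M , j≤M

  Arc-irreflexive : ∀ {i} → ¬ Arc i i
  Arc-irreflexive (i≤M , _ , ii) = subst T (loopless D (vertex i≤M)) ii

  out-atMostTwo : (∀ v → outdeg D v ≤ 2) → ∀ w → AtMostTwo (Arc w)
  out-atMostTwo out≤2 w (w≤M , a≤M , wa) (_ , b≤M , wb) (_ , c≤M , wc) =
    Sum.map (vertex-injective a≤M b≤M) (Sum.map (vertex-injective a≤M c≤M) (vertex-injective b≤M c≤M))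
      (filter-length≤2⇒AtMostTwo (T? ∘ arc D (vertex w≤M)) (out≤2 (vertex w≤M)) wa wb wc)

  in-atMostTwo : (∀ v → indeg D v ≤ 2) → ∀ w → AtMostTwo (λ v → Arc v w)
  in-atMostTwo in≤2 w (a≤M , w≤M , aw) (b≤M , _ , bw) (c≤M , _ , cw) =
    Sum.map (vertex-injective a≤M b≤M) (Sum.map (vertex-injective a≤M c≤M) (vertex-injective b≤M c≤M))
      (filter-length≤2⇒AtMostTwo (λ v → T? (arc D v (vertex w≤M))) (in≤2 (vertex w≤M)) aw bw cw)

  edge-realised : ∀ {i} → i < M → CommonNeighbours Arc i (suc i)
  edge-realised {i} i<M with reflect (vertex (<⇒≤ i<M)) (vertex i<M) (inj₁ positions-adjacent)
    where
    positions-adjacent : position (vertex i<M) ≡ suc (position (vertex (<⇒≤ i<M)))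
    positions-adjacent = trans (position-vertex i<M) (cong suc (sym (position-vertex (<⇒≤ i<M))))
  ... | _ , x , y , yu , yv , ux , vx =
    subst₂ (CommonNeighbours Arc) (position-vertex (<⇒≤ i<M)) (position-vertex i<M)
      (commonNeighbours (arc⇒Arc yu) (arc⇒Arc yv) (arc⇒Arc ux) (arc⇒Arc vx))

  ends-unrealised : 2 ≤ M → ¬ CommonNeighbours Arc 0 M
  ends-unrealised 2≤M (commonNeighbours (s≤M , 0≤M , s0) (_ , M≤M , sM) (_ , t≤M , 0t) (_ , _ , Mt)) =
    [ (λ M≡1+0 → <-irrefl (sym (trans (sym (position-vertex M≤M)) (trans M≡1+0 (cong suc (position-vertex 0≤M))))) 2≤M)
    , (λ 0≡1+M → 0≢1+n (trans (sym (position-vertex 0≤M)) (trans 0≡1+M (cong suc (position-vertex M≤M)))))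
    ]′ (preserve (vertex 0≤M) (vertex M≤M) (0≢M , vertex t≤M , vertex s≤M , s0 , sM , 0t , Mt))
    where
    0≢M : vertex 0≤M ≢ vertex M≤M
    0≢M eq = <⇒≢ (≤-trans (s≤s z≤n) 2≤M) (vertex-injective 0≤M M≤M eq)

lemma3p2 : ∀ (m : ℕ) → m ≥ 2 → ∀ (n : ℕ) (D : Digraph n) →
    Is22 D → ¬ Iso (CCEAdj D) (PathAdj m)
lemma3p2 (suc M) (s≤s 1≤M) n D is22 iso =
  PathRealisation.impossible 1≤M Arc-bounded Arc-irreflexive
    (out-atMostTwo (proj₂ ∘ is22)) (in-atMostTwo (proj₁ ∘ is22)) edge-realised ends-unrealised
  where open Positions D iso
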